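{- Let $\ell\ge 2$, let $G$ be an $A$-AW graph with a pendant vertex, and let $t\in T_{V(G)}^{A(G)}(1)$. Then $\overline{G}$ is $N$-AW if and only if $\gcd(1+t,\ell)=1$.
   Context: All graphs are finite and simple; labels lie in $\mathbb{Z}_\ell$. In the adjacency Lights Out game on a graph $G$, each vertex carries a label in $\mathbb{Z}_\ell$; toggling a vertex $v$ adds $1$ (mod $\ell$) to the label of each neighbor of $v$; in the neighborhood Lights Out game toggling $v$ adds $1$ to the label of every vertex of the closed neighborhood $N[v]$; a game is won when all labels are $0$. $G$ is $A$-AW (resp. $N$-AW) if the adjacency (resp. neighborhood) game on $G$ can be won from every initial labeling. For $U\subseteq V(G)$ and $r\in\mathbb{Z}_\ell$, let $\mathbf{0}_{U,r}$ be the labeling that is $r$ on $U$ and $0$ elsewhere; $T_U^{A(G)}(r)\subseteq\mathbb{Z}_\ell$ is the set of all $t$ such that the adjacency game with initial labeling $\mathbf{0}_{U,r}$ can be won with the vertices of $U$ toggled collectively $t$ times (mod $\ell$). $\overline{G}$ is the complement of $G$. -}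

module Defs where

open import Data.Nat using (ℕ; zero; suc; _+_; _*_)
open import Data.Fin using (Fin; zero; suc)
open import Data.Fin.Properties using (_≟_)
open import Data.Bool using (Bool; true; false; not; _∧_; _∨_; if_then_else_)
open import Data.Product using (Σ; _×_)
open import Relation.Nullary.Decidable using (⌊_⌋)
open import Relation.Binary.PropositionalEquality using (_≡_)

record Graph : Set where
  field
    n     : ℕ
    adj   : Fin n → Fin n → Bool
    sym   : ∀ u v → adj u v ≡ adj v u
    irref : ∀ v → adj v v ≡ false
open Graph public

sumFin : (k : ℕ) → (Fin k → ℕ) → ℕ
sumFin zero    f = 0
sumFin (suc k) f = f zero + sumFin k (λ i → f (suc i))

[_] : Bool → ℕ
[ b ] = if b then 1 else 0

-- Congruence modulo ℓ on ℕ (labels in ℤ_ℓ are represented by naturals).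
_≡_[mod_] : ℕ → ℕ → ℕ → Set
a ≡ b [mod ℓ ] = Σ ℕ λ i → Σ ℕ λ j → a + i * ℓ ≡ b + j * ℓ

complement : Graph → Graph
complement G = record
  { n = n G
  ; adj = λ u v → not (adj G u v) ∧ not ⌊ u ≟ v ⌋
  ; sym = symC
  ; irref = irrC }
  where
  open import Relation.Binary.PropositionalEquality using (refl; cong₂; cong)
  open import Relation.Nullary using (yes; no)
  symC : ∀ u v → (not (adj G u v) ∧ not ⌊ u ≟ v ⌋) ≡ (not (adj G v u) ∧ not ⌊ v ≟ u ⌋)
  symC u v with u ≟ v | v ≟ u
  ... | yes _ | yes _ = cong₂ _∧_ (cong not (sym G u v)) refl
  ... | no _  | no _  = cong₂ _∧_ (cong not (sym G u v)) refl
  ... | yes refl | no ¬p = Data.Empty.⊥-elim (¬p refl) where import Data.Empty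
  ... | no ¬p | yes refl = Data.Empty.⊥-elim (¬p refl) where import Data.Empty
  irrC : ∀ v → (not (adj G v v) ∧ not ⌊ v ≟ v ⌋) ≡ false
  irrC v with v ≟ v
  ... | yes _ = Data.Bool.Properties.∧-zeroʳ (not (adj G v v))
    where import Data.Bool.Properties
  ... | no ¬p = Data.Empty.⊥-elim (¬p refl) where import Data.Empty

-- Adjacency game: toggling u adds 1 to each neighbour of u.
-- Final label at v from initial labeling c and toggle counts x.
adjResult : (G : Graph) → (Fin (n G) → ℕ) → (Fin (n G) → ℕ) → Fin (n G) → ℕ
adjResult G c x v = c v + sumFin (n G) (λ u → [ adj G u v ] * x u)

nbhdResult : (G : Graph) → (Fin (n G) → ℕ) → (Fin (n G) → ℕ) → Fin (n G) → ℕ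
nbhdResult G c x v = c v + sumFin (n G) (λ u → [ adj G u v ∨ ⌊ u ≟ v ⌋ ] * x u)

AWins : (ℓ : ℕ) (G : Graph) → (Fin (n G) → ℕ) → (Fin (n G) → ℕ) → Set
AWins ℓ G c x = ∀ v → adjResult G c x v ≡ 0 [mod ℓ ]

NWins : (ℓ : ℕ) (G : Graph) → (Fin (n G) → ℕ) → (Fin (n G) → ℕ) → Set
NWins ℓ G c x = ∀ v → nbhdResult G c x v ≡ 0 [mod ℓ ]

A-AW : ℕ → Graph → Set
A-AW ℓ G = ∀ (c : Fin (n G) → ℕ) → Σ (Fin (n G) → ℕ) λ x → AWins ℓ G c x

N-AW : ℕ → Graph → Set
N-AW ℓ G = ∀ (c : Fin (n G) → ℕ) → Σ (Fin (n G) → ℕ) λ x → NWins ℓ G c x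

-- Subsets U of V(G) as characteristic Bool functions.
-- 0_{U,r}: r on U, 0 elsewhere.
zeroLab : (G : Graph) → (Fin (n G) → Bool) → ℕ → Fin (n G) → ℕ
zeroLab G U r v = [ U v ] * r

-- t ∈ T_U^{A(G)}(r): the game from 0_{U,r} can be won with vertices of U
-- toggled collectively t times (mod ℓ).
InT : (ℓ : ℕ) (G : Graph) → (Fin (n G) → Bool) → ℕ → ℕ → Set
InT ℓ G U r t = Σ (Fin (n G) → ℕ) λ x →
  AWins ℓ G (zeroLab G U r) x × (sumFin (n G) (λ u → [ U u ] * x u) ≡ t [mod ℓ ])

degree : (G : Graph) → Fin (n G) → ℕ
degree G v = sumFin (n G) (λ u → [ adj G v u ])

HasPendant : Graph → Set
HasPendant G = Σ (Fin (n G)) λ v → degree G v ≡ 1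

-- Write A for the adjacency matrix of G and J for the all-ones matrix. Toggling y in the
-- neighbourhood game on the complement adds (J - A) y, so y wins from c iff A y ≡ c + (Σ y) 1
-- (mod ℓ). Fix x with A x ≡ -1 and Σ x ≡ t. Since A is symmetric, pairing such a y with x gives
-- x·c + (1 + t) Σ y ≡ 0; taking for c the column of A at any vertex (so x·c ≡ -1) shows that
-- 1 + t is a unit. Conversely, if 1 + t is a unit, solve A a ≡ c (G is A-AW) and correct a by a
-- multiple of x so that the total toggle count satisfies the remaining scalar condition.
module Submission where

open import Defs
open import Data.Nat using (ℕ; _+_; _≤_; _<_)
open import Data.Nat.GCD using (gcd)
open import Data.Bool using (true)
open import Data.Product using (_×_)
open import Relation.Binary.PropositionalEquality using (_≡_)

open import Data.Bool using (false; _∨_)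
open import Data.Fin using (Fin; zero; suc)
open import Data.Fin.Properties using (_≟_)
open import Data.Nat using (zero; suc; _*_; pred; NonZero)
import Data.Nat.Properties as ℕ
open import Algebra.Properties.Semiring.Sum ℕ.+-*-semiring
  using (sum; sum-cong-≗; ∑-distrib-+; ∑-comm; *-distribˡ-sum; *-distribʳ-sum)
open import Data.Nat.Coprimality using (coprime⇒gcd≡1; gcd≡1⇒coprime; coprime-Bézout)
open import Data.Nat.Divisibility using (_∣_; ∣1⇒≡1; ∣m+n∣m⇒∣n; ∣m⇒∣m*n; ∣n⇒∣m*n; ∣m∣n⇒∣m+n)
open import Data.Nat.GCD using (module Bézout)
open import Data.Nat.Tactic.RingSolver using (solve-∀)
open import Data.Product using (∃; _,_; proj₂)
open import Data.Vec.Functional using (Vector)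
open import Relation.Binary.Bundles using (Setoid)
open import Relation.Binary.PropositionalEquality as ≡ using (refl; cong; cong₂; subst; subst₂)
open import Relation.Nullary using (yes; no)
open import Relation.Nullary.Decidable using (⌊_⌋)

sumFin≡sum : ∀ k (f : Vector ℕ k) → sumFin k f ≡ sum f
sumFin≡sum zero    f = refl
sumFin≡sum (suc k) f = cong (f zero +_) (sumFin≡sum k (λ i → f (suc i)))

sumFin-1* : ∀ k (x : Vector ℕ k) → sumFin k (λ i → 1 * x i) ≡ sum x
sumFin-1* k x = ≡.trans (sumFin≡sum k _) (sum-cong-≗ λ i → ℕ.*-identityˡ (x i))

module Modular (ℓ : ℕ) where

  infix 4 _≈_
  _≈_ : ℕ → ℕ → Set
  a ≈ b = a ≡ b [mod ℓ ]

  ≡⇒≈ : ∀ {a b} → a ≡ b → a ≈ b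
  ≡⇒≈ refl = 0 , 0 , refl

  ≈-refl : ∀ {a} → a ≈ a
  ≈-refl = ≡⇒≈ refl

  ≈-sym : ∀ {a b} → a ≈ b → b ≈ a
  ≈-sym (i , j , eq) = j , i , ≡.sym eq

  private
    +-*-assoc : ∀ a i j l → a + (i + j) * l ≡ (a + i * l) + j * l
    +-*-assoc = solve-∀

    +-swapʳ : ∀ a b c → (a + b) + c ≡ (a + c) + b
    +-swapʳ = solve-∀

  ≈-trans : ∀ {a b c} → a ≈ b → b ≈ c → a ≈ c
  ≈-trans {a} {b} {c} (i , j , p) (i′ , j′ , q) = i + i′ , j′ + j , (begin
    a + (i + i′) * ℓ       ≡⟨ +-*-assoc a i i′ ℓ ⟩
    (a + i * ℓ) + i′ * ℓ   ≡⟨ cong (_+ i′ * ℓ) p ⟩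
    (b + j * ℓ) + i′ * ℓ   ≡⟨ +-swapʳ b (j * ℓ) (i′ * ℓ) ⟩
    (b + i′ * ℓ) + j * ℓ   ≡⟨ cong (_+ j * ℓ) q ⟩
    (c + j′ * ℓ) + j * ℓ   ≡⟨ +-*-assoc c j′ j ℓ ⟨
    c + (j′ + j) * ℓ       ∎)
    where open ≡.≡-Reasoning

  ≈-setoid : Setoid _ _
  ≈-setoid = record
    { Carrier       = ℕ
    ; _≈_           = _≈_
    ; isEquivalence = record { refl = ≈-refl ; sym = ≈-sym ; trans = ≈-trans }
    }

  +-cong : ∀ {a b c d} → a ≈ b → c ≈ d → a + c ≈ b + d
  +-cong {a} {b} {c} {d} (i , j , p) (i′ , j′ , q) = i + i′ , j + j′ , (begin
    (a + c) + (i + i′) * ℓ       ≡⟨ interchange a c i i′ ℓ ⟩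
    (a + i * ℓ) + (c + i′ * ℓ)   ≡⟨ cong₂ _+_ p q ⟩
    (b + j * ℓ) + (d + j′ * ℓ)   ≡⟨ interchange b d j j′ ℓ ⟨
    (b + d) + (j + j′) * ℓ       ∎)
    where
    open ≡.≡-Reasoning
    interchange : ∀ a c i i′ l → (a + c) + (i + i′) * l ≡ (a + i * l) + (c + i′ * l)
    interchange = solve-∀

  +-congˡ : ∀ a {b c} → b ≈ c → a + b ≈ a + c
  +-congˡ a = +-cong (≈-refl {a})

  +-congʳ : ∀ c {a b} → a ≈ b → a + c ≈ b + c
  +-congʳ c a≈b = +-cong a≈b (≈-refl {c})

  *-congˡ : ∀ k {a b} → a ≈ b → k * a ≈ k * b
  *-congˡ k {a} {b} (i , j , eq) = k * i , k * j , (begin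
    k * a + k * i * ℓ   ≡⟨ distrib k a i ℓ ⟩
    k * (a + i * ℓ)     ≡⟨ cong (k *_) eq ⟩
    k * (b + j * ℓ)     ≡⟨ distrib k b j ℓ ⟨
    k * b + k * j * ℓ   ∎)
    where
    open ≡.≡-Reasoning
    distrib : ∀ k a i l → k * a + k * i * l ≡ k * (a + i * l)
    distrib = solve-∀

  *-congʳ : ∀ k {a b} → a ≈ b → a * k ≈ b * k
  *-congʳ k {a} {b} eq =
    subst₂ _≈_ (ℕ.*-comm k a) (ℕ.*-comm k b) (*-congˡ k eq)

  +-cancelʳ : ∀ c {a b} → a + c ≈ b + c → a ≈ b
  +-cancelʳ c {a} {b} (i , j , eq) = i , j , ℕ.+-cancelʳ-≡ c _ _ (begin
    (a + i * ℓ) + c   ≡⟨ +-swapʳ a (i * ℓ) c ⟩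
    (a + c) + i * ℓ   ≡⟨ eq ⟩
    (b + c) + j * ℓ   ≡⟨ +-swapʳ b (j * ℓ) c ⟨
    (b + j * ℓ) + c   ∎)
    where open ≡.≡-Reasoning

  *ℓ≈0 : ∀ k → k * ℓ ≈ 0
  *ℓ≈0 k = 0 , k , ℕ.+-identityʳ (k * ℓ)

  ∑-cong : ∀ {k} {f g : Vector ℕ k} → (∀ i → f i ≈ g i) → sum f ≈ sum g
  ∑-cong {zero}  f≈g = ≈-refl
  ∑-cong {suc k} f≈g = +-cong (f≈g zero) (∑-cong (λ i → f≈g (suc i)))

  open import Relation.Binary.Reasoning.Setoid ≈-setoid

  +-inverse : .{{NonZero ℓ}} → ∀ a → a + pred ℓ * a ≈ 0
  +-inverse a = begin
    a + pred ℓ * a   ≡⟨ cong (_* a) (ℕ.suc-pred ℓ) ⟩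
    ℓ * a            ≡⟨ ℕ.*-comm ℓ a ⟩
    a * ℓ            ≈⟨ *ℓ≈0 a ⟩
    0                ∎

  inverse-unique : ∀ {a b c} → a + b ≈ 0 → a + c ≈ 0 → b ≈ c
  inverse-unique {a} {b} {c} a+b≈0 a+c≈0 = begin
    b             ≈⟨ +-congʳ b a+c≈0 ⟨
    (a + c) + b   ≡⟨ +-swapʳ a c b ⟩
    (a + b) + c   ≈⟨ +-congʳ c a+b≈0 ⟩
    c             ∎

  invertible⇒gcd≡1 : ∀ {a s} → a * s ≈ 1 → gcd a ℓ ≡ 1
  invertible⇒gcd≡1 {a} {s} (i , j , eq) = coprime⇒gcd≡1 {a} {ℓ} λ {d} (d∣a , d∣ℓ) →
    let d∣as+iℓ = ∣m∣n⇒∣m+n (∣m⇒∣m*n s d∣a) (∣n⇒∣m*n i d∣ℓ)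
        d∣jℓ+1  = subst (d ∣_) (≡.trans eq (ℕ.+-comm 1 (j * ℓ))) d∣as+iℓ
    in  ∣1⇒≡1 (∣m+n∣m⇒∣n d∣jℓ+1 (∣n⇒∣m*n j d∣ℓ))

  gcd≡1⇒negInvertible : .{{NonZero ℓ}} → ∀ {a} → gcd a ℓ ≡ 1 → ∃ λ m → 1 + m * a ≈ 0
  gcd≡1⇒negInvertible {a} gcd≡1 with coprime-Bézout (gcd≡1⇒coprime gcd≡1)
  ... | Bézout.+- x y eq = pred ℓ * x , (begin
    1 + pred ℓ * x * a                     ≡⟨ cong (1 +_) (ℕ.*-assoc (pred ℓ) x a) ⟩
    1 + pred ℓ * (x * a)                   ≡⟨ cong (λ xa → 1 + pred ℓ * xa) eq ⟨
    1 + pred ℓ * (1 + y * ℓ)               ≡⟨ expand (pred ℓ) y ℓ ⟩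
    (1 + pred ℓ * 1) + pred ℓ * y * ℓ      ≈⟨ +-cong (+-inverse 1) (*ℓ≈0 (pred ℓ * y)) ⟩
    0                                      ∎)
    where
    expand : ∀ p y l → 1 + p * (1 + y * l) ≡ (1 + p * 1) + p * y * l
    expand = solve-∀
  ... | Bézout.-+ x y eq = x , ≈-trans (≡⇒≈ eq) (*ℓ≈0 y)

infix 7 _·_
_·_ : ∀ {k} → Vector ℕ k → Vector ℕ k → ℕ
x · y = sum (λ i → x i * y i)

·-distribʳ-+ : ∀ {k} (x y z : Vector ℕ k) → x · (λ i → y i + z i) ≡ x · y + x · z
·-distribʳ-+ x y z =
  ≡.trans (sum-cong-≗ (λ i → ℕ.*-distribˡ-+ (x i) (y i) (z i)))
          (∑-distrib-+ (λ i → x i * y i) (λ i → x i * z i))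

·-scaleʳ : ∀ {k} (x z : Vector ℕ k) m → x · (λ i → m * z i) ≡ m * (x · z)
·-scaleʳ x z m = ≡.trans (sum-cong-≗ λ i → commute (x i) m (z i))
                         (≡.sym (*-distribˡ-sum m (λ i → x i * z i)))
  where
  commute : ∀ a m b → a * (m * b) ≡ m * (a * b)
  commute = solve-∀

·-constʳ : ∀ {k} (x : Vector ℕ k) m → x · (λ _ → m) ≡ sum x * m
·-constʳ x m = ≡.sym (*-distribʳ-sum m x)

·-comm : ∀ {k} (x y : Vector ℕ k) → x · y ≡ y · x
·-comm x y = sum-cong-≗ (λ i → ℕ.*-comm (x i) (y i))

column : (G : Graph) → Fin (n G) → Vector ℕ (n G)
column G v u = [ adj G u v ]

neighbourSum : (G : Graph) → Vector ℕ (n G) → Vector ℕ (n G)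
neighbourSum G x v = column G v · x

adjResult≡neighbourSum : (G : Graph) (c x : Vector ℕ (n G)) (v : Fin (n G)) →
             adjResult G c x v ≡ c v + neighbourSum G x v
adjResult≡neighbourSum G c x v = cong (c v +_) (sumFin≡sum (n G) _)

neighbourSum-selfAdjoint : (G : Graph) (x y : Vector ℕ (n G)) →
                           x · neighbourSum G y ≡ y · neighbourSum G x
neighbourSum-selfAdjoint G x y = begin
  x · neighbourSum G y
    ≡⟨ sum-cong-≗ (λ v → *-distribˡ-sum (x v) (λ u → [ adj G u v ] * y u)) ⟩
  sum (λ v → sum (λ u → x v * ([ adj G u v ] * y u)))
    ≡⟨ ∑-comm (λ v u → x v * ([ adj G u v ] * y u)) ⟩
  sum (λ u → sum (λ v → x v * ([ adj G u v ] * y u)))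
    ≡⟨ sum-cong-≗ (λ u → sum-cong-≗ (λ v → transpose u v)) ⟩
  sum (λ u → sum (λ v → y u * ([ adj G v u ] * x v)))
    ≡⟨ sum-cong-≗ (λ u → *-distribˡ-sum (y u) (λ v → [ adj G v u ] * x v)) ⟨
  y · neighbourSum G x ∎
  where
  open ≡.≡-Reasoning
  rotate : ∀ a b c → a * (b * c) ≡ c * (b * a)
  rotate = solve-∀
  transpose : ∀ u v → x v * ([ adj G u v ] * y u) ≡ y u * ([ adj G v u ] * x v)
  transpose u v rewrite sym G u v = rotate (x v) [ adj G v u ] (y u)

complement-closedNbhd+adj≡1 : (G : Graph) (u v : Fin (n G)) →
                              [ adj (complement G) u v ∨ ⌊ u ≟ v ⌋ ] + [ adj G u v ] ≡ 1
complement-closedNbhd+adj≡1 G u v with u ≟ v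
... | yes refl rewrite irref G u = refl
... | no _ with adj G u v
...   | true  = refl
...   | false = refl

nbhdResult-complement : (G : Graph) (c y : Vector ℕ (n G)) (v : Fin (n G)) →
                        nbhdResult (complement G) c y v + neighbourSum G y v ≡ c v + sum y
nbhdResult-complement G c y v = begin
  c v + sumFin (n G) (λ u → closed u * y u) + column G v · y
    ≡⟨ cong (λ s → c v + s + column G v · y) (sumFin≡sum (n G) _) ⟩
  c v + sum (λ u → closed u * y u) + column G v · y
    ≡⟨ ℕ.+-assoc (c v) _ _ ⟩
  c v + (sum (λ u → closed u * y u) + column G v · y)
    ≡⟨ cong (c v +_) (∑-distrib-+ (λ u → closed u * y u) (λ u → column G v u * y u)) ⟨
  c v + sum (λ u → closed u * y u + column G v u * y u)
    ≡⟨ cong (c v +_) (sum-cong-≗ partition) ⟩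
  c v + sum y ∎
  where
  open ≡.≡-Reasoning
  closed : Fin (n G) → ℕ
  closed u = [ adj (complement G) u v ∨ ⌊ u ≟ v ⌋ ]
  partition : ∀ u → closed u * y u + column G v u * y u ≡ y u
  partition u = begin
    closed u * y u + column G v u * y u   ≡⟨ ℕ.*-distribʳ-+ (y u) (closed u) _ ⟨
    (closed u + column G v u) * y u       ≡⟨ cong (_* y u) (complement-closedNbhd+adj≡1 G u v) ⟩
    1 * y u                               ≡⟨ ℕ.*-identityˡ (y u) ⟩
    y u                                   ∎

module ComplementGame (ℓ : ℕ) (G : Graph) where

  open Modular ℓ
  open import Relation.Binary.Reasoning.Setoid ≈-setoid

  AWins⇒neighbourSum : ∀ {c x} → AWins ℓ G c x → ∀ v → c v + neighbourSum G x v ≈ 0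
  AWins⇒neighbourSum {c} {x} wins v =
    ≈-trans (≡⇒≈ (≡.sym (adjResult≡neighbourSum G c x v))) (wins v)

  NeighbourSumSurjective : Set
  NeighbourSumSurjective = ∀ (c : Vector ℕ (n G)) → ∃ λ a → ∀ v → neighbourSum G a v ≈ c v

  A-AW⇒neighbourSum-surjective : .{{NonZero ℓ}} → A-AW ℓ G → NeighbourSumSurjective
  A-AW⇒neighbourSum-surjective aw c with aw (λ v → pred ℓ * c v)
  ... | a , wins = a , λ v →
    inverse-unique (AWins⇒neighbourSum {λ v → pred ℓ * c v} {a} wins v)
                   (≈-trans (≡⇒≈ (ℕ.+-comm (pred ℓ * c v) (c v))) (+-inverse (c v)))

  NWins-complement⇒neighbourSum : ∀ {c y} → NWins ℓ (complement G) c y →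
                      ∀ v → neighbourSum G y v ≈ c v + sum y
  NWins-complement⇒neighbourSum {c} {y} wins v = begin
    neighbourSum G y v
      ≈⟨ +-congʳ (neighbourSum G y v) (wins v) ⟨
    nbhdResult (complement G) c y v + neighbourSum G y v
      ≡⟨ nbhdResult-complement G c y v ⟩
    c v + sum y ∎

  neighbourSum⇒NWins-complement : ∀ {c y} m → (∀ v → neighbourSum G y v + m ≈ c v) → sum y + m ≈ 0 →
                      NWins ℓ (complement G) c y
  neighbourSum⇒NWins-complement {c} {y} m Ay+m≈c Σy+m≈0 v = +-cancelʳ (c v) (begin
    nbhd + c v                               ≈⟨ +-congˡ nbhd (Ay+m≈c v) ⟨
    nbhd + (neighbourSum G y v + m)          ≡⟨ ℕ.+-assoc nbhd _ m ⟨
    (nbhd + neighbourSum G y v) + m          ≡⟨ cong (_+ m) (nbhdResult-complement G c y v) ⟩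
    (c v + sum y) + m                        ≡⟨ ℕ.+-assoc (c v) (sum y) m ⟩
    c v + (sum y + m)                        ≈⟨ +-congˡ (c v) Σy+m≈0 ⟩
    c v + 0                                  ≡⟨ ℕ.+-comm (c v) 0 ⟩
    0 + c v                                  ∎)
    where
    nbhd = nbhdResult (complement G) c y v

  module AllOnesSolution (x : Vector ℕ (n G)) (t : ℕ)
                         (1+Ax≈0 : ∀ u → 1 + neighbourSum G x u ≈ 0) (Σx≈t : sum x ≈ t) where

    NWins-complement⇒pairing : ∀ {c y} → NWins ℓ (complement G) c y →
                               (1 + t) * sum y + x · c ≈ 0
    NWins-complement⇒pairing {c} {y} wins = begin
      (1 + t) * sum y + x · c
        ≈⟨ +-congʳ (x · c) (*-congʳ (sum y) (+-congˡ 1 Σx≈t)) ⟨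
      (1 + sum x) * sum y + x · c
        ≡⟨ regroup (sum x) (sum y) (x · c) ⟩
      sum y + (x · c + sum x * sum y)
        ≡⟨ cong (λ s → sum y + (x · c + s)) (·-constʳ x (sum y)) ⟨
      sum y + (x · c + x · (λ _ → sum y))
        ≡⟨ cong (sum y +_) (·-distribʳ-+ x c _) ⟨
      sum y + x · (λ v → c v + sum y)
        ≈⟨ +-congˡ (sum y) (∑-cong λ v → *-congˡ (x v) (NWins-complement⇒neighbourSum wins v)) ⟨
      sum y + x · neighbourSum G y
        ≡⟨ cong (sum y +_) (neighbourSum-selfAdjoint G x y) ⟩
      sum y + y · neighbourSum G x
        ≡⟨ cong (_+ y · neighbourSum G x) Σy≡y·1 ⟩
      y · (λ _ → 1) + y · neighbourSum G x
        ≡⟨ ·-distribʳ-+ y _ _ ⟨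
      y · (λ u → 1 + neighbourSum G x u)
        ≈⟨ ∑-cong (λ u → *-congˡ (y u) (1+Ax≈0 u)) ⟩
      y · (λ _ → 0)
        ≡⟨ ≡.trans (·-constʳ y 0) (ℕ.*-zeroʳ (sum y)) ⟩
      0 ∎
      where
      regroup : ∀ σ s p → (1 + σ) * s + p ≡ s + (p + σ * s)
      regroup = solve-∀
      Σy≡y·1 : sum y ≡ y · (λ _ → 1)
      Σy≡y·1 = ≡.sym (≡.trans (·-constʳ y 1) (ℕ.*-identityʳ (sum y)))

    -- Any vertex v₀ works: the column of A at v₀ pairs with x to -1.
    complement-N-AW⇒invertible : Fin (n G) → N-AW ℓ (complement G) → ∃ λ s → (1 + t) * s ≈ 1
    complement-N-AW⇒invertible v₀ naw with naw (column G v₀)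
    ... | y , wins = sum y , (begin
      (1 + t) * sum y
        ≡⟨ ℕ.+-identityʳ _ ⟨
      (1 + t) * sum y + 0
        ≈⟨ +-congˡ ((1 + t) * sum y) (1+Ax≈0 v₀) ⟨
      (1 + t) * sum y + (1 + column G v₀ · x)
        ≡⟨ cong (λ p → (1 + t) * sum y + (1 + p)) (·-comm _ x) ⟩
      (1 + t) * sum y + (1 + x · column G v₀)
        ≡⟨ shuffle ((1 + t) * sum y) (x · column G v₀) ⟩
      1 + ((1 + t) * sum y + x · column G v₀)
        ≈⟨ +-congˡ 1 (NWins-complement⇒pairing wins) ⟩
      1 + 0 ∎)
      where
      shuffle : ∀ a p → a + (1 + p) ≡ 1 + (a + p)
      shuffle = solve-∀

    negInvertible⇒complement-N-AW : NeighbourSumSurjective → (∃ λ m → 1 + m * (1 + t) ≈ 0) →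
                                    N-AW ℓ (complement G)
    negInvertible⇒complement-N-AW onto (m , 1+m[1+t]≈0) c with onto c
    ... | a , Aa≈c = y , neighbourSum⇒NWins-complement k Ay+k≈c Σy+k≈0
      where
      -- Adding k x to a shifts A a by -k and Σ a by k t; this k makes Σ y ≡ -k.
      k : ℕ
      k = sum a * m
      y : Vector ℕ (n G)
      y u = a u + k * x u
      factor : ∀ p k q → p + k * q + k ≡ p + k * (1 + q)
      factor = solve-∀
      Ay+k≈c : ∀ v → neighbourSum G y v + k ≈ c v
      Ay+k≈c v = begin
        neighbourSum G y v + k
          ≡⟨ cong (_+ k) (·-distribʳ-+ (column G v) a _) ⟩
        column G v · a + column G v · (λ i → k * x i) + k
          ≡⟨ cong (λ s → column G v · a + s + k) (·-scaleʳ (column G v) x k) ⟩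
        neighbourSum G a v + k * neighbourSum G x v + k
          ≡⟨ factor _ k _ ⟩
        neighbourSum G a v + k * (1 + neighbourSum G x v)
          ≈⟨ +-cong (Aa≈c v) (*-congˡ k (1+Ax≈0 v)) ⟩
        c v + k * 0
          ≡⟨ ≡.trans (cong (c v +_) (ℕ.*-zeroʳ k)) (ℕ.+-identityʳ (c v)) ⟩
        c v ∎
      Σy+k≈0 : sum y + k ≈ 0
      Σy+k≈0 = begin
        sum y + k                          ≡⟨ cong (_+ k) (∑-distrib-+ a _) ⟩
        sum a + sum (λ i → k * x i) + k    ≡⟨ cong (λ s → sum a + s + k) (*-distribˡ-sum k x) ⟨
        sum a + k * sum x + k              ≡⟨ factor _ k _ ⟩
        sum a + k * (1 + sum x)            ≈⟨ +-congˡ (sum a) (*-congˡ k (+-congˡ 1 Σx≈t)) ⟩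
        sum a + sum a * m * (1 + t)        ≡⟨ distrib (sum a) m (1 + t) ⟩
        sum a * (1 + m * (1 + t))          ≈⟨ *-congˡ (sum a) 1+m[1+t]≈0 ⟩
        sum a * 0                          ≡⟨ ℕ.*-zeroʳ (sum a) ⟩
        0                                  ∎
        where
        distrib : ∀ s m u → s + s * m * u ≡ s * (1 + m * u)
        distrib = solve-∀

corollary3p7 : (ℓ : ℕ) → 2 ≤ ℓ → (G : Graph) → A-AW ℓ G → HasPendant G →
    (t : ℕ) → t < ℓ → InT ℓ G (λ _ → true) 1 t →
    (N-AW ℓ (complement G) → gcd (1 + t) ℓ ≡ 1) × (gcd (1 + t) ℓ ≡ 1 → N-AW ℓ (complement G))
corollary3p7 ℓ@(suc _) _ G aw (v₀ , _) t _ (x , wins , total) = forward , backward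
  where
  open Modular ℓ
  open ComplementGame ℓ G
  Σx≈t : sum x ≈ t
  Σx≈t = ≈-trans (≡⇒≈ (≡.sym (sumFin-1* (n G) x))) total
  open AllOnesSolution x t (AWins⇒neighbourSum wins) Σx≈t
  forward : N-AW ℓ (complement G) → gcd (1 + t) ℓ ≡ 1
  forward naw = invertible⇒gcd≡1 {1 + t} (proj₂ (complement-N-AW⇒invertible v₀ naw))
  backward : gcd (1 + t) ℓ ≡ 1 → N-AW ℓ (complement G)
  backward gcd≡1 =
    negInvertible⇒complement-N-AW (A-AW⇒neighbourSum-surjective aw) (gcd≡1⇒negInvertible gcd≡1)
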